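{- Let $\mathcal{P}$ be a finite nonempty set of trees with pairwise disjoint state sets and $\Pi$ any stochastic partition of $S_\mathcal{P}$. Then $P\preceq\mathcal{P}/\Pi$ for every $P\in\mathcal{P}$.
   Context: All probabilities are rationals. $\mathrm{Dist}(S)$: discrete distributions on $S$; $\delta_g$ is the Dirac distribution at $g$. An LPTS is $\langle S,s^0,\alpha,\tau\rangle$, finite $S$, start state $s^0$, finite actions $\alpha$, finite $\tau\subseteq S\times\alpha\times\mathrm{Dist}(S)$; $s\xrightarrow{a}\mu$ means $(s,a,\mu)\in\tau$. $\mu_1\sqsubseteq_R\mu_2$ iff there is a weight function $w:S_1\times S_2\to\mathbb{Q}\cap[0,1]$ with row sums $\mu_1$, column sums $\mu_2$ and $w(s_1,s_2)>0\Rightarrow s_1Rs_2$; $R$ is a strong simulation iff $s_1Rs_2$, $s_1\xrightarrow{a}\mu_1$ imply some $s_2\xrightarrow{a}\mu_2$ with $\mu_1\sqsubseteq_R\mu_2$; $L_1\preceq L_2$ iff a strong simulation relates the start states. A tree is an LPTS whose start state (root) is in the support of no transition distribution and each other state $s$ is in the support of exactly one, and then $\mathrm{parent}(s)$ is the source state of that transition. $S_\mathcal{P}=\bigcup_{P\in\mathcal{P}}S_P$. A stochastic partition of $S_\mathcal{P}$ is a pair $(G,\{[s]\}_{s\in S_\mathcal{P}})$ with $G\subseteq 2^{S_\mathcal{P}}$, $\bigcup G=S_\mathcal{P}$, each $[s]$ a partial function $G\to\mathrm{Dist}(G)$, such that: (1) there is $g^0\in G$ with $[s^0_P](g)=\delta_{g^0}$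 for every $P\in\mathcal{P}$, $g\in G$; (2) for every non-root $s$ and $g\in G$, $[s](g)$ is defined iff $[\mathrm{parent}(s)](g')(g)>0$ for some $g'$; moreover $s\in g$ iff $[s](g')(g)>0$ for some $g'\in G$. Convention: $[s](g')(g)=0$ if $[s](g')$ is undefined. The quotient $\mathcal{P}/\Pi$ is $\langle G,g^0,\bigcup_P\alpha_P,\tau\rangle$ where $(g,a,\mu)\in\tau$ iff there exist $P\in\mathcal{P}$, $(s,a,\mu_p)\in\tau_P$ with $s\in g$ and $\mu(g')=\sum_{s'\in g'}[s'](g)(g')\mu_p(s')$ for all $g'\in G$. -}

module Defs where

open import Data.Nat using (ℕ; zero; suc)
open import Data.Fin using (Fin; zero; suc; _≟_)
open import Data.Rational using (ℚ; 0ℚ; 1ℚ; _+_; _*_; _≤_; _<_)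
open import Data.Product using (Σ; ∃; _×_; _,_; proj₁; proj₂)
open import Data.List using (List)
open import Data.List.Membership.Propositional using (_∈_)
open import Data.Maybe using (Maybe; just; nothing; Is-just)
open import Data.Bool using (Bool; true; false; if_then_else_)
open import Relation.Binary.PropositionalEquality using (_≡_; _≢_)
open import Relation.Nullary using (¬_; yes; no)
open import Function.Bundles using (_⇔_)

∑ : ∀ {n} → (Fin n → ℚ) → ℚ
∑ {zero}  f = 0ℚ
∑ {suc n} f = f zero + ∑ (λ i → f (suc i))

record Dist (n : ℕ) : Set where
  field
    prob   : Fin n → ℚ
    nonneg : ∀ i → 0ℚ ≤ prob i
    total  : ∑ prob ≡ 1ℚ
open Dist public

δ : ∀ {n} → Fin n → Fin n → ℚ
δ g h with g ≟ h
... | yes _ = 1ℚ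
... | no  _ = 0ℚ

record LPTS (Act : Set) : Set where
  field
    size       : ℕ
    start      : Fin size
    acts       : List Act
    trans      : List (Fin size × Act × Dist size)
    trans-acts : ∀ {s a μ} → (s , a , μ) ∈ trans → a ∈ acts
open LPTS public

-- A (finite-state) probabilistic transition structure given by a
-- transition predicate; used for strong simulation (which only refers
-- to states, start state and transitions).
record PTS (Act : Set) : Set₁ where
  field
    nst   : ℕ
    init  : Fin nst
    Step  : Fin nst → Act → Dist nst → Set
open PTS public

toPTS : ∀ {Act} → LPTS Act → PTS Act
toPTS L = record { nst = size L ; init = start L
                 ; Step = λ s a μ → (s , a , μ) ∈ trans L }

Lift : ∀ {n₁ n₂} → (Fin n₁ → Fin n₂ → Set) → Dist n₁ → Dist n₂ → Set
Lift {n₁} {n₂} R μ₁ μ₂ =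
  Σ (Fin n₁ → Fin n₂ → ℚ) λ w →
      (∀ s₁ s₂ → (0ℚ ≤ w s₁ s₂) × (w s₁ s₂ ≤ 1ℚ))
    × (∀ s₁ → ∑ (λ s₂ → w s₁ s₂) ≡ prob μ₁ s₁)
    × (∀ s₂ → ∑ (λ s₁ → w s₁ s₂) ≡ prob μ₂ s₂)
    × (∀ s₁ s₂ → 0ℚ < w s₁ s₂ → R s₁ s₂)

IsStrongSimulation : ∀ {Act} (L₁ L₂ : PTS Act) →
  (Fin (nst L₁) → Fin (nst L₂) → Set) → Set
IsStrongSimulation {Act} L₁ L₂ R =
  ∀ s₁ s₂ (a : Act) μ₁ → R s₁ s₂ → Step L₁ s₁ a μ₁ →
  Σ (Dist (nst L₂)) λ μ₂ → Step L₂ s₂ a μ₂ × Lift R μ₁ μ₂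

_≼_ : ∀ {Act} → PTS Act → PTS Act → Set₁
L₁ ≼ L₂ = Σ (Fin (nst L₁) → Fin (nst L₂) → Set) λ R →
            IsStrongSimulation L₁ L₂ R × R (init L₁) (init L₂)

InSupport : ∀ {n} → Dist n → Fin n → Set
InSupport μ s = 0ℚ < prob μ s

IsTree : ∀ {Act} → LPTS Act → Set
IsTree L =
    (∀ {p a μ} → (p , a , μ) ∈ trans L → ¬ InSupport μ (start L))
  × (∀ s → s ≢ start L →
        (Σ (Fin (size L)) λ p → Σ _ λ a → Σ (Dist (size L)) λ μ →
            ((p , a , μ) ∈ trans L) × InSupport μ s)
      × (∀ {p a μ p' a' μ'} → (p , a , μ) ∈ trans L → InSupport μ s →
            (p' , a' , μ') ∈ trans L → InSupport μ' s →
            (p ≡ p') × (a ≡ a') × (∀ t → prob μ t ≡ prob μ' t)))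

-- p is the source of a transition whose distribution has s in its support
-- (for a tree and non-root s this is exactly p = parent(s))
IsParent : ∀ {Act} (L : LPTS Act) → Fin (size L) → Fin (size L) → Set
IsParent L p s = Σ _ λ a → Σ (Dist (size L)) λ μ →
                   ((p , a , μ) ∈ trans L) × InSupport μ s

-- A family of K trees with pairwise disjoint state sets: the union of the
-- state sets is represented as the disjoint union Σ i. Fin (size (P i)).

SP : ∀ {Act K} → (Fin K → LPTS Act) → Set
SP {K = K} P = Σ (Fin K) λ i → Fin (size (P i))

app : ∀ {m} → Maybe (Dist m) → Fin m → ℚ
app nothing  g = 0ℚ
app (just d) g = prob d g

-- Stochastic partition.  G is represented by Fin m together with the
-- membership predicate mem (distinct indices denote distinct subsets).
record StochasticPartition {Act : Set} {K : ℕ} (P : Fin K → LPTS Act) : Set where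
  field
    m        : ℕ
    mem      : Fin m → SP P → Bool
    distinct : ∀ g g' → (∀ s → mem g s ≡ mem g' s) → g ≡ g'
    covers   : ∀ s → Σ (Fin m) λ g → mem g s ≡ true
    cls      : SP P → Fin m → Maybe (Dist m)
    g0       : Fin m
    root     : ∀ i g → Σ (Dist m) λ d →
                 (cls (i , start (P i)) g ≡ just d) × (∀ h → prob d h ≡ δ g0 h)
    defined  : ∀ i (s : Fin (size (P i))) → s ≢ start (P i) →
                 ∀ p → IsParent (P i) p s → ∀ g →
                 Is-just (cls (i , s) g) ⇔
                   (Σ (Fin m) λ g' → 0ℚ < app (cls (i , p) g') g)
    member   : ∀ s g → (mem g s ≡ true) ⇔
                 (Σ (Fin m) λ g' → 0ℚ < app (cls s g') g)
open StochasticPartition public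

Quotient : ∀ {Act K} (P : Fin K → LPTS Act) → StochasticPartition P → PTS Act
Quotient {Act} {K} P Π = record
  { nst  = m Π
  ; init = g0 Π
  ; Step = λ g a μ →
      Σ (Fin K) λ i → Σ (Fin (size (P i))) λ s → Σ (Dist (size (P i))) λ μp →
          ((s , a , μp) ∈ trans (P i))
        × (mem Π g (i , s) ≡ true)
        × (∀ g' → prob μ g' ≡
             ∑ (λ s' → if mem Π g' (i , s')
                         then app (cls Π (i , s') g) g' * prob μp s'
                         else 0ℚ))
  }

-- Relate each state of a tree to every class containing it. A transition s →a μ with
-- s ∈ g is matched by the quotient transition that g inherits from it, and the weight
-- of (s', g') is the summand of that transition's probability of g'.  Its row sums are
-- μ because every child s' of s has [s'](g) defined: s ∈ g means g is reachable from
-- [s], and by condition (2) this makes [s'](g) a distribution.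
module Submission where

open import Defs
open import Algebra.Bundles using (Ring)
open import Data.Bool using (Bool; true; false; if_then_else_)
open import Data.Empty using (⊥-elim)
open import Data.Fin using (Fin; zero; suc)
open import Data.List.Membership.Propositional using (_∈_)
open import Data.Maybe using (Maybe; just; nothing; Is-just)
open import Data.Maybe.Relation.Unary.Any using (just)
open import Data.Nat using (ℕ; suc)
open import Data.Product using (_,_; proj₁)
open import Data.Rational using (ℚ; 0ℚ; 1ℚ; _+_; _*_; _≤_; _<_; nonNegative)
open import Data.Rational.Properties
open import Function using (_∘_; case_of_; Equivalence)
open import Relation.Binary.PropositionalEquality hiding (trans)
open import Relation.Binary.PropositionalEquality as ≡ using ()
open import Relation.Nullary using (¬_; yes; no)

open import Algebra.Properties.Semiring.Sum (Ring.semiring +-*-ring)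
  using (sum; sum-cong-≗; *-distribʳ-sum; sum-replicate-zero)
  renaming (∑-comm to sum-comm)

∑≡sum : ∀ {n} (f : Fin n → ℚ) → ∑ f ≡ sum f
∑≡sum {ℕ.zero} f = refl
∑≡sum {suc n} f = cong (f zero +_) (∑≡sum (f ∘ suc))

∑-cong : ∀ {n} {f g : Fin n → ℚ} → (∀ i → f i ≡ g i) → ∑ f ≡ ∑ g
∑-cong {f = f} {g} f≗g = ≡.trans (∑≡sum f) (≡.trans (sum-cong-≗ f≗g) (sym (∑≡sum g)))

∑-zero : ∀ n → ∑ {n} (λ _ → 0ℚ) ≡ 0ℚ
∑-zero n = ≡.trans (∑≡sum {n} (λ _ → 0ℚ)) (sum-replicate-zero n)

∑-*ʳ : ∀ {n} (f : Fin n → ℚ) c → ∑ (λ i → f i * c) ≡ ∑ f * c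
∑-*ʳ f c = begin
  ∑ (λ i → f i * c)    ≡⟨ ∑≡sum (λ i → f i * c) ⟩
  sum (λ i → f i * c)  ≡⟨ *-distribʳ-sum c f ⟨
  sum f * c            ≡⟨ cong (_* c) (∑≡sum f) ⟨
  ∑ f * c              ∎
  where open ≡-Reasoning

∑-comm : ∀ {m n} (f : Fin m → Fin n → ℚ) →
         ∑ (λ i → ∑ (f i)) ≡ ∑ (λ j → ∑ (λ i → f i j))
∑-comm f = begin
  ∑ (λ i → ∑ (f i))                ≡⟨ ∑-cong (∑≡sum ∘ f) ⟩
  ∑ (λ i → sum (f i))              ≡⟨ ∑≡sum (λ i → sum (f i)) ⟩
  sum (λ i → sum (f i))            ≡⟨ sum-comm f ⟩
  sum (λ j → sum (λ i → f i j))    ≡⟨ ∑≡sum (λ j → sum (λ i → f i j)) ⟨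
  ∑ (λ j → sum (λ i → f i j))      ≡⟨ ∑-cong (λ j → ∑≡sum (λ i → f i j)) ⟨
  ∑ (λ j → ∑ (λ i → f i j))        ∎
  where open ≡-Reasoning

∑-nonneg : ∀ {n} {f : Fin n → ℚ} → (∀ i → 0ℚ ≤ f i) → 0ℚ ≤ ∑ f
∑-nonneg {ℕ.zero} f≥0 = ≤-refl
∑-nonneg {suc n} f≥0 = +-mono-≤ (f≥0 zero) (∑-nonneg (f≥0 ∘ suc))

≤-∑ : ∀ {n} {f : Fin n → ℚ} → (∀ i → 0ℚ ≤ f i) → ∀ j → f j ≤ ∑ f
≤-∑ {suc n} {f} f≥0 zero =
  subst (_≤ ∑ f) (+-identityʳ (f zero)) (+-monoʳ-≤ (f zero) (∑-nonneg (f≥0 ∘ suc)))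
≤-∑ {suc n} {f} f≥0 (suc j) =
  subst (_≤ ∑ f) (+-identityˡ (f (suc j))) (+-mono-≤ (f≥0 zero) (≤-∑ (f≥0 ∘ suc) j))

prob≤1 : ∀ {n} (μ : Dist n) s → prob μ s ≤ 1ℚ
prob≤1 μ s = subst (prob μ s ≤_) (total μ) (≤-∑ (nonneg μ) s)

*-nonneg : ∀ {p q} → 0ℚ ≤ p → 0ℚ ≤ q → 0ℚ ≤ p * q
*-nonneg {p} {q} p≥0 q≥0 =
  subst (_≤ p * q) (*-zeroˡ q) (*-monoʳ-≤-nonNeg q {{nonNegative q≥0}} p≥0)

nonneg∧≯0⇒≡0 : ∀ {p} → 0ℚ ≤ p → ¬ 0ℚ < p → p ≡ 0ℚ
nonneg∧≯0⇒≡0 p≥0 p≯0 = ≤-antisym (≮⇒≥ p≯0) p≥0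

δ-diag : ∀ {n} (g : Fin n) → δ g g ≡ 1ℚ
δ-diag g with g Data.Fin.≟ g
... | yes _  = refl
... | no g≢g = ⊥-elim (g≢g refl)

app-nonneg : ∀ {m} (x : Maybe (Dist m)) g → 0ℚ ≤ app x g
app-nonneg nothing  g = ≤-refl
app-nonneg (just d) g = nonneg d g

module Pushforward {n m} (μ : Dist n) (κ : Fin n → Maybe (Dist m))
  (R : Fin n → Fin m → Bool)
  (κ-defined : ∀ s → 0ℚ < prob μ s → Is-just (κ s))
  (κ-within-R : ∀ s g → 0ℚ < app (κ s) g → R s g ≡ true) where

  weight : Fin n → Fin m → ℚ
  weight s g = if R s g then app (κ s) g * prob μ s else 0ℚ

  weight-unguarded : ∀ s g → weight s g ≡ app (κ s) g * prob μ s
  weight-unguarded s g with R s g in Rsg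
  ... | true  = refl
  ... | false = sym (≡.trans (cong (_* prob μ s) κsg≡0) (*-zeroˡ (prob μ s)))
    where
    κsg≡0 : app (κ s) g ≡ 0ℚ
    κsg≡0 = nonneg∧≯0⇒≡0 (app-nonneg (κ s) g) λ κsg>0 →
              case ≡.trans (sym Rsg) (κ-within-R s g κsg>0) of λ ()

  weight-nonneg : ∀ s g → 0ℚ ≤ weight s g
  weight-nonneg s g rewrite weight-unguarded s g =
    *-nonneg (app-nonneg (κ s) g) (nonneg μ s)

  weight-within-R : ∀ s g → 0ℚ < weight s g → R s g ≡ true
  weight-within-R s g with R s g
  ... | true  = λ _ → refl
  ... | false = λ 0<0 → ⊥-elim (<-irrefl refl 0<0)

  ∑-app≡1 : ∀ s → 0ℚ < prob μ s → ∑ (app (κ s)) ≡ 1ℚ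
  ∑-app≡1 s μs>0 with κ s | κ-defined s μs>0
  ... | just d | just _ = total d

  weight-vanishes : ∀ s → prob μ s ≡ 0ℚ → ∀ g → weight s g ≡ 0ℚ
  weight-vanishes s μs≡0 g = begin
    weight s g                ≡⟨ weight-unguarded s g ⟩
    app (κ s) g * prob μ s    ≡⟨ cong (app (κ s) g *_) μs≡0 ⟩
    app (κ s) g * 0ℚ          ≡⟨ *-zeroʳ (app (κ s) g) ⟩
    0ℚ                        ∎
    where open ≡-Reasoning

  weight-row : ∀ s → ∑ (weight s) ≡ prob μ s
  weight-row s with 0ℚ <? prob μ s
  ... | yes μs>0 = begin
    ∑ (weight s)                        ≡⟨ ∑-cong (weight-unguarded s) ⟩
    ∑ (λ g → app (κ s) g * prob μ s)    ≡⟨ ∑-*ʳ (app (κ s)) (prob μ s) ⟩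
    ∑ (app (κ s)) * prob μ s            ≡⟨ cong (_* prob μ s) (∑-app≡1 s μs>0) ⟩
    1ℚ * prob μ s                       ≡⟨ *-identityˡ (prob μ s) ⟩
    prob μ s                            ∎
    where open ≡-Reasoning
  ... | no μs≯0 = begin
    ∑ (weight s)        ≡⟨ ∑-cong (weight-vanishes s μs≡0) ⟩
    ∑ {m} (λ _ → 0ℚ)    ≡⟨ ∑-zero m ⟩
    0ℚ                  ≡⟨ μs≡0 ⟨
    prob μ s            ∎
    where
    open ≡-Reasoning
    μs≡0 : prob μ s ≡ 0ℚ
    μs≡0 = nonneg∧≯0⇒≡0 (nonneg μ s) μs≯0

  pushforward : Dist m
  pushforward = record
    { prob   = λ g → ∑ (λ s → weight s g)
    ; nonneg = λ g → ∑-nonneg (λ s → weight-nonneg s g)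
    ; total  = ≡.trans (sym (∑-comm weight)) (≡.trans (∑-cong weight-row) (total μ))
    }

  weight≤1 : ∀ s g → weight s g ≤ 1ℚ
  weight≤1 s g = begin
    weight s g      ≤⟨ ≤-∑ (weight-nonneg s) g ⟩
    ∑ (weight s)    ≡⟨ weight-row s ⟩
    prob μ s        ≤⟨ prob≤1 μ s ⟩
    1ℚ              ∎
    where open ≤-Reasoning

  lift : Lift (λ s g → R s g ≡ true) μ pushforward
  lift = weight , (λ s g → weight-nonneg s g , weight≤1 s g) , weight-row
       , (λ _ → refl) , weight-within-R

module Membership {Act : Set} {k : ℕ} (P : Fin (suc k) → LPTS Act)
  (Π : StochasticPartition P) (i : Fin (suc k)) where

  _∈ᶜ_ : Fin (size (P i)) → Fin (m Π) → Set
  s ∈ᶜ g = mem Π g (i , s) ≡ true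

  charged⇒∈ᶜ : ∀ s g g' → 0ℚ < app (cls Π (i , s) g') g → s ∈ᶜ g
  charged⇒∈ᶜ s g g' p = Equivalence.from (member Π (i , s) g) (g' , p)

  start∈ᶜg0 : start (P i) ∈ᶜ g0 Π
  start∈ᶜg0 with root Π i (g0 Π)
  ... | d , cls≡d , d≗δ = charged⇒∈ᶜ (start (P i)) (g0 Π) (g0 Π)
    (subst (λ x → 0ℚ < app x (g0 Π)) (sym cls≡d)
      (subst (0ℚ <_) (sym (≡.trans (d≗δ (g0 Π)) (δ-diag (g0 Π)))) (positive⁻¹ 1ℚ)))

  child-class-defined :
    (∀ {p a μ} → (p , a , μ) ∈ trans (P i) → ¬ InSupport μ (start (P i))) →
    ∀ {s a μ} → (s , a , μ) ∈ trans (P i) → ∀ {g} → s ∈ᶜ g →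
    ∀ s' → 0ℚ < prob μ s' → Is-just (cls Π (i , s') g)
  child-class-defined start-unreached {s} {a} {μ} s→μ {g} s∈g s' μs'>0 =
    Equivalence.from (defined Π i s' s'≢start s (a , μ , s→μ , μs'>0) g)
                     (Equivalence.to (member Π (i , s) g) s∈g)
    where
    s'≢start : s' ≢ start (P i)
    s'≢start refl = start-unreached s→μ μs'>0

lemma9 : {Act : Set} {k : ℕ} (P : Fin (suc k) → LPTS Act) →
    (∀ i → IsTree (P i)) → (Π : StochasticPartition P) →
    ∀ i → toPTS (P i) ≼ Quotient P Π
lemma9 P tree Π i = _∈ᶜ_ , simulation , start∈ᶜg0
  where
  open Membership P Π i

  simulation : IsStrongSimulation (toPTS (P i)) (Quotient P Π) _∈ᶜ_
  simulation s g a μ s∈g s→μ =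
    pushforward , (i , s , μ , s→μ , s∈g , λ _ → refl) , lift
    where
    open Pushforward μ (λ s' → cls Π (i , s') g) (λ s' g' → mem Π g' (i , s'))
           (child-class-defined (proj₁ (tree i)) s→μ s∈g) (λ s' g' → charged⇒∈ᶜ s' g' g)
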